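{- Let $C=(I,V,E,O)$ be a CDAG and $S\ge 1$, and let $H^{NR}$ be the minimal number of vertex sets in any valid $2S^{NR}$-partitioning of $C$. Then the minimal number $Q$ of I/O operations over all complete calculations on $C$ in the recompute-restricted red-blue pebble game with $S$ red pebbles (i.e., without any repebbling) satisfies $Q\ge S\cdot(H^{NR}-1)$.
   Context: A CDAG is a 4-tuple $C=(I,V,E,O)$ of finite sets with $E\subseteq V\times V$, $(V,E)$ a directed acyclic graph, $I\subseteq V$ (inputs) consisting of vertices with no incoming edges, and $O\subseteq V$ (outputs); vertices without predecessors need not be inputs and vertices without successors need not be outputs. Recompute-restricted red-blue pebble game: with $S$ red pebbles and arbitrarily many blue pebbles, start with a blue pebble on each vertex of $I$. Moves: R1 place a red pebble on a vertex carrying a blue pebble; R2 place a blue pebble on a vertex carrying a red pebble; R3-NR if all immediate predecessors of $v\in V\setminus I$ carry red pebbles (vacuous if none) and a red pebble has never previously been placed on $v$, place a red pebble on $v$; R4 remove a red pebble from any vertex. At most $S$ red pebbles may be on the graph at any time. A complete calculation is a sequence of moves in which each vertex of $V\setminus I$ is fired exactly once by R3-NR and which ends with blue pebbles on all vertices of $O$; its number of I/O operations is the number of R1 and R2 moves. A $2S^{NR}$-partitioning of $C$ is a collection of $h$ subsets $V_1,\dots,V_h$ of $V\setminus I$ such that: (P1) they are pairwise disjoint with union $V\setminus I$; (P2) the graph on $\{V_1,\dots,V_h\}$ with an arc $V_i\to V_j$ ($i\neq j$) whenever $E$ contains an edge from $V_i$ to $V_j$ is acyclic; (P3) $|\mathrm{In}(V_i)|\le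 2S$ for all $i$; (P4) $|\mathrm{Out}(V_i)|\le 2S$ for all $i$, where $\mathrm{In}(V_i)$ is the set of vertices of $V\setminus V_i$ with at least one successor in $V_i$, and $\mathrm{Out}(V_i)$ is the set of vertices of $V_i$ that belong to $O$ or have at least one successor outside $V_i$. -}

module Defs where

open import Data.Nat using (ℕ; zero; suc; _+_; _*_; _≤_)
open import Data.Bool using (Bool; true; false; _∧_; _∨_; not)
open import Data.Fin using (Fin; zero; suc)
open import Data.Fin.Subset using (Subset; _∈_; _∉_; ⁅_⁆; _∪_; _─_; ∣_∣; ⊥)
open import Data.Vec using (lookup; tabulate)
open import Data.Product using (Σ; ∃; _×_; _,_)
open import Data.Empty using () renaming (⊥ to Empty)
open import Relation.Binary.PropositionalEquality using (_≡_; _≢_)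
open import Relation.Nullary using (¬_)

anyB : ∀ {n} → (Fin n → Bool) → Bool
anyB {zero}  f = false
anyB {suc n} f = f zero ∨ anyB (λ i → f (suc i))

data Path {A : Set} (R : A → A → Set) : A → A → Set where
  step : ∀ {x y} → R x y → Path R x y
  _then_ : ∀ {x y z} → R x y → Path R y z → Path R x z

Acyclic : {A : Set} → (A → A → Set) → Set
Acyclic {A} R = ∀ (x : A) → ¬ Path R x x

-- A CDAG C = (I, V, E, O) with V = Fin n (vertices), E given as a Boolean adjacency
record CDAG : Set where
  field
    n        : ℕ
    E        : Fin n → Fin n → Bool          -- E u v ≡ true : edge u → v
    I        : Subset n
    O        : Subset n
    acyclic  : Acyclic (λ u v → E u v ≡ true)
    inputs-no-pred : ∀ u v → v ∈ I → E u v ≡ false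
open CDAG public

module _ (C : CDAG) where
  private
    m = n C
    inS : Fin m → Subset m → Bool
    inS v A = lookup A v

  InSet : Subset m → Subset m
  InSet A = tabulate λ u → not (inS u A) ∧ anyB (λ v → E C u v ∧ inS v A)

  OutSet : Subset m → Subset m
  OutSet A = tabulate λ u → inS u A ∧ (inS u (O C) ∨ anyB (λ v → E C u v ∧ not (inS v A)))

  record Partition2S (S : ℕ) (h : ℕ) : Set where
    field
      block    : Fin h → Subset m
      sub      : ∀ i v → v ∈ block i → v ∉ I C
      disjoint : ∀ i j v → i ≢ j → v ∈ block i → v ∈ block j → Empty
      cover    : ∀ v → v ∉ I C → ∃ λ i → v ∈ block i
      quotAcyclic : Acyclic (λ i j → i ≢ j × Σ (Fin m) λ u → Σ (Fin m) λ v →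
                                 u ∈ block i × v ∈ block j × E C u v ≡ true)
      inBound  : ∀ i → ∣ InSet (block i) ∣ ≤ 2 * S
      outBound : ∀ i → ∣ OutSet (block i) ∣ ≤ 2 * S

  IsMinPartitionCount : ℕ → ℕ → Set
  IsMinPartitionCount S H = Partition2S S H × (∀ h → Partition2S S h → H ≤ h)

  -- Game state: red pebbles, blue pebbles, vertices already fired by R3-NR
  record State : Set where
    constructor st
    field
      red blue fired : Subset m

  initial : State
  initial = st ⊥ (I C) ⊥

  -- one move with S red pebbles; the ℕ index is its I/O cost
  data Move (S : ℕ) : State → State → ℕ → Set where
    R1 : ∀ {r b f} v → v ∈ b → ∣ r ∪ ⁅ v ⁆ ∣ ≤ S → Move S (st r b f) (st (r ∪ ⁅ v ⁆) b f) 1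
    R2 : ∀ {r b f} v → v ∈ r → Move S (st r b f) (st r (b ∪ ⁅ v ⁆) f) 1
    R3NR : ∀ {r b f} v → v ∉ I C → (∀ u → E C u v ≡ true → u ∈ r) → v ∉ f →
           ∣ r ∪ ⁅ v ⁆ ∣ ≤ S → Move S (st r b f) (st (r ∪ ⁅ v ⁆) b (f ∪ ⁅ v ⁆)) 0
    R4 : ∀ {r b f} v → v ∈ r → Move S (st r b f) (st (r ─ ⁅ v ⁆) b f) 0

  data Run (S : ℕ) : State → State → ℕ → Set where
    done : ∀ {s} → Run S s s 0
    _∷_  : ∀ {s s′ s″ c q} → Move S s s′ c → Run S s′ s″ q → Run S s s″ (c + q)

  Complete : State → Set
  Complete s = (∀ v → v ∉ I C → v ∈ State.fired s) × (∀ v → v ∈ O C → v ∈ State.blue s)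

module Submission where

-- Cut a complete calculation of cost Q into consecutive segments, each containing
-- exactly S I/O moves except the last one, which contains at most S.  With h + 1
-- segments, S * h ≤ Q.  Let block i be the set of vertices fired (by R3-NR) during
-- segment i.  Since every non-input vertex is fired exactly once, the blocks
-- partition V \ I (P1); predecessors are fired first, so an edge never leads from a
-- block to an earlier one, and ordering blocks by their index shows (P2).  A vertex
-- of In(block i) is red when segment i starts or is touched by one of its I/O moves;
-- a vertex of Out(block i) is red when segment i ends or is touched by one of its
-- I/O moves, since otherwise it is "dead": it never carries a pebble again, so it
-- can neither be a blue output at the end nor feed a vertex fired later.  Hence
-- both sets have at most S + S elements (P3, P4), the blocks form a
-- 2S^NR-partitioning with h + 1 sets, H ≤ h + 1, and S * (H ∸ 1) ≤ S * h ≤ Q.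

open import Defs
open import Data.Nat using (ℕ; _≤_; _*_; _∸_)
open import Data.Nat using (zero; suc; _+_; _<_; z≤n; s≤s; _≤?_)
open import Data.Nat.Properties hiding (_≟_)
open import Data.Bool using (Bool; true; false; _∧_; _∨_; not)
open import Data.Fin using (Fin; zero; suc; toℕ; _≟_)
open import Data.Fin.Properties using (toℕ-injective)
open import Data.Fin.Subset using (Subset; _∈_; _∉_; ⁅_⁆; _∪_; _─_; ∣_∣; ⊥; _⊆_; inside; outside)
open import Data.Fin.Subset.Properties
  using (_∈?_; x∈p∪q⁻; x∈p∪q⁺; x∈⁅y⁆⇒x≡y; x∈⁅x⁆; ∣⁅x⁆∣≡1; p⊆q⇒∣p∣≤∣q∣; ∉⊥; ∣⊥∣≡0;
         x∈p∧x∉q⇒x∈p─q; p─q⊆p; p⊆p∪q; q⊆p∪q; ∣p∣≤∣x∷p∣)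
open import Data.Vec using ([]; _∷_; here; there; lookup; tabulate)
open import Data.Vec.Properties using ([]=⇒lookup; lookup⇒[]=; lookup∘tabulate)
open import Data.Product using (Σ; ∃; _×_; _,_; proj₁; proj₂)
open import Data.Sum using (_⊎_; inj₁; inj₂; map₁; map₂)
open import Data.Empty using (⊥-elim) renaming (⊥ to Empty)
open import Function using (id; _∘_; case_of_)
open import Relation.Binary.PropositionalEquality
open import Relation.Nullary using (¬_; yes; no; contradiction)

∈⇒lookup : ∀ {k} {x : Fin k} {p : Subset k} → x ∈ p → lookup p x ≡ true
∈⇒lookup = []=⇒lookup

lookup⇒∈ : ∀ {k} {x : Fin k} {p : Subset k} → lookup p x ≡ true → x ∈ p
lookup⇒∈ {x = x} {p} = lookup⇒[]= x p

lookup-false⇒∉ : ∀ {k} {x : Fin k} {p : Subset k} → lookup p x ≡ false → x ∉ p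
lookup-false⇒∉ eq x∈p = case trans (sym (∈⇒lookup x∈p)) eq of λ ()

∈tabulate⇒ : ∀ {k} {f : Fin k → Bool} {x} → x ∈ tabulate f → f x ≡ true
∈tabulate⇒ {f = f} {x} x∈ = trans (sym (lookup∘tabulate f x)) (∈⇒lookup x∈)

∧-true⁻ : ∀ {a b} → a ∧ b ≡ true → a ≡ true × b ≡ true
∧-true⁻ {true} {true} refl = refl , refl

∨-true⁻ : ∀ {a b} → a ∨ b ≡ true → a ≡ true ⊎ b ≡ true
∨-true⁻ {true} refl = inj₁ refl
∨-true⁻ {false} b≡true = inj₂ b≡true

not-true⁻ : ∀ {a} → not a ≡ true → a ≡ false
not-true⁻ {false} refl = refl

anyB-witness : ∀ {k} (f : Fin k → Bool) → anyB f ≡ true → ∃ λ v → f v ≡ true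
anyB-witness {zero} f ()
anyB-witness {suc k} f any with f zero in eq
... | true = zero , eq
... | false with anyB-witness (f ∘ suc) any
...   | v , fv = suc v , fv

∈∪⁅⁆⁻ : ∀ {k} {x y : Fin k} {p : Subset k} → x ∈ p ∪ ⁅ y ⁆ → x ∈ p ⊎ x ≡ y
∈∪⁅⁆⁻ {y = y} {p} x∈ = map₂ (x∈⁅y⁆⇒x≡y y) (x∈p∪q⁻ p ⁅ y ⁆ x∈)

∈∪⁅⁆-≢ : ∀ {k} {x y : Fin k} {p : Subset k} → x ∈ p ∪ ⁅ y ⁆ → x ≢ y → x ∈ p
∈∪⁅⁆-≢ x∈ x≢y with ∈∪⁅⁆⁻ x∈
... | inj₁ x∈p = x∈p
... | inj₂ x≡y = contradiction x≡y x≢y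

∉∪⁅⁆ : ∀ {k} {x y : Fin k} {p : Subset k} → x ∉ p → x ≢ y → x ∉ p ∪ ⁅ y ⁆
∉∪⁅⁆ x∉p x≢y x∈ with ∈∪⁅⁆⁻ x∈
... | inj₁ x∈p = x∉p x∈p
... | inj₂ x≡y = x≢y x≡y

∈∉⇒≢ : ∀ {k} {x y : Fin k} {p : Subset k} → x ∈ p → y ∉ p → x ≢ y
∈∉⇒≢ x∈p y∉p refl = y∉p x∈p

shift-singleton : ∀ {k} {x y : Fin k} {p t : Subset k} →
                  x ∈ p ∪ ⁅ y ⁆ ⊎ x ∈ t → x ∈ p ⊎ x ∈ t ∪ ⁅ y ⁆
shift-singleton {y = y} {t = t} (inj₁ x∈) with ∈∪⁅⁆⁻ x∈
... | inj₁ x∈p = inj₁ x∈p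
... | inj₂ refl = inj₂ (q⊆p∪q t ⁅ y ⁆ (x∈⁅x⁆ y))
shift-singleton {y = y} (inj₂ x∈t) = inj₂ (p⊆p∪q ⁅ y ⁆ x∈t)

x∈p─q⇒x∉q : ∀ {k} {x : Fin k} (p q : Subset k) → x ∈ p ─ q → x ∉ q
x∈p─q⇒x∉q (_ ∷ p) (outside ∷ q) here ()
x∈p─q⇒x∉q (_ ∷ p) (inside ∷ q) () here
x∈p─q⇒x∉q (_ ∷ p) (_ ∷ q) (there x∈) (there x∈q) = x∈p─q⇒x∉q p q x∈ x∈q

x∈p∧x∉p─q⇒x∈q : ∀ {k} {x : Fin k} {p q : Subset k} → x ∈ p → x ∉ p ─ q → x ∈ q
x∈p∧x∉p─q⇒x∈q {x = x} {q = q} x∈p x∉p─q with x ∈? q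
... | yes x∈q = x∈q
... | no x∉q = contradiction (x∈p∧x∉q⇒x∈p─q x∈p x∉q) x∉p─q

∣p∪q∣≤∣p∣+∣q∣ : ∀ {k} (p q : Subset k) → ∣ p ∪ q ∣ ≤ ∣ p ∣ + ∣ q ∣
∣p∪q∣≤∣p∣+∣q∣ [] [] = z≤n
∣p∪q∣≤∣p∣+∣q∣ (true ∷ p) (b ∷ q) = s≤s (≤-trans (∣p∪q∣≤∣p∣+∣q∣ p q) (+-monoʳ-≤ ∣ p ∣ (∣p∣≤∣x∷p∣ b q)))
∣p∪q∣≤∣p∣+∣q∣ (false ∷ p) (true ∷ q) = ≤-trans (s≤s (∣p∪q∣≤∣p∣+∣q∣ p q)) (≤-reflexive (sym (+-suc ∣ p ∣ ∣ q ∣)))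
∣p∪q∣≤∣p∣+∣q∣ (false ∷ p) (false ∷ q) = ∣p∪q∣≤∣p∣+∣q∣ p q

∣p∪⁅x⁆∣≤1+∣p∣ : ∀ {k} (p : Subset k) (x : Fin k) → ∣ p ∪ ⁅ x ⁆ ∣ ≤ suc ∣ p ∣
∣p∪⁅x⁆∣≤1+∣p∣ p x = ≤-trans (∣p∪q∣≤∣p∣+∣q∣ p ⁅ x ⁆)
                      (≤-reflexive (trans (cong (∣ p ∣ +_) (∣⁅x⁆∣≡1 x)) (+-comm ∣ p ∣ 1)))

card-cover : ∀ {k} {X Y Z : Subset k} → (∀ {x} → x ∈ Y → x ∈ X ⊎ x ∈ Z) → ∣ Y ∣ ≤ ∣ X ∣ + ∣ Z ∣
card-cover {X = X} {Z = Z} cover = ≤-trans (p⊆q⇒∣p∣≤∣q∣ (x∈p∪q⁺ ∘ cover)) (∣p∪q∣≤∣p∣+∣q∣ X Z)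

peel-fuel : ∀ {S q f} → 1 ≤ S → q ≤ suc f → q ∸ S ≤ f
peel-fuel {q = q} 1≤S q≤1+f = ≤-trans (∸-monoʳ-≤ q 1≤S) (∸-monoˡ-≤ 1 q≤1+f)

peel-cost : ∀ {S q h} → S ≤ q → S * h ≤ q ∸ S → S * suc h ≤ q
peel-cost {S} {q} {h} S≤q Sh≤rest = begin
  S * suc h    ≡⟨ *-suc S h ⟩
  S + S * h    ≤⟨ +-monoʳ-≤ S Sh≤rest ⟩
  S + (q ∸ S)  ≡⟨ m+[n∸m]≡n S≤q ⟩
  q            ∎
  where open ≤-Reasoning

measure⇒acyclic : ∀ {A : Set} {R : A → A → Set} (μ : A → ℕ) →
                  (∀ {x y} → R x y → μ x < μ y) → Acyclic R
measure⇒acyclic {R = R} μ increases _ cycle = <-irrefl refl (along cycle)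
  where
  along : ∀ {x y} → Path R x y → μ x < μ y
  along (step r) = increases r
  along (r then p) = <-trans (increases r) (along p)

module _ (C : CDAG) where

  InSet-member : ∀ {A u} → u ∈ InSet C A → u ∉ A × ∃ λ v → E C u v ≡ true × v ∈ A
  InSet-member u∈In with ∧-true⁻ (∈tabulate⇒ u∈In)
  ... | u∉A , hasSucc with anyB-witness _ hasSucc
  ...   | v , ev with ∧-true⁻ ev
  ...     | e , v∈A = lookup-false⇒∉ (not-true⁻ u∉A) , v , e , lookup⇒∈ v∈A

  OutSet-member : ∀ {A u} → u ∈ OutSet C A →
                  u ∈ A × (u ∈ O C ⊎ ∃ λ w → E C u w ≡ true × w ∉ A)
  OutSet-member u∈Out with ∧-true⁻ (∈tabulate⇒ u∈Out)
  ... | u∈A , why with ∨-true⁻ why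
  ...   | inj₁ isOut = lookup⇒∈ u∈A , inj₁ (lookup⇒∈ isOut)
  ...   | inj₂ hasSucc with anyB-witness _ hasSucc
  ...     | w , ew with ∧-true⁻ ew
  ...       | e , w∉A = lookup⇒∈ u∈A , inj₂ (w , e , lookup-false⇒∉ (not-true⁻ w∉A))

  edge-target-noninput : ∀ {u w} → E C u w ≡ true → w ∉ I C
  edge-target-noninput {u} {w} e w∈I = case trans (sym e) (inputs-no-pred C u w w∈I) of λ ()

module Game (C : CDAG) (S : ℕ) where
  open State

  private variable
    s s′ s″ : State C
    c h q : ℕ
    u v w : Fin (n C)

  Settled : State C → Fin (n C) → Set
  Settled s u = u ∈ fired s ⊎ u ∈ I C

  settled-grow : ∀ {f} v → u ∈ f ⊎ u ∈ I C → u ∈ f ∪ ⁅ v ⁆ ⊎ u ∈ I C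
  settled-grow v = map₁ (p⊆p∪q ⁅ v ⁆)

  record WellFormed (s : State C) : Set where
    field
      red-settled    : u ∈ red s → Settled s u
      blue-settled   : u ∈ blue s → Settled s u
      fired-noninput : u ∈ fired s → u ∉ I C
      fired-closed   : v ∈ fired s → E C u v ≡ true → Settled s u
      capacity       : ∣ red s ∣ ≤ S
  open WellFormed

  wf-initial : WellFormed (initial C)
  wf-initial = record
    { red-settled    = ⊥-elim ∘ ∉⊥
    ; blue-settled   = inj₂
    ; fired-noninput = ⊥-elim ∘ ∉⊥
    ; fired-closed   = λ v∈ _ → ⊥-elim (∉⊥ v∈)
    ; capacity       = ≤-trans (≤-reflexive (∣⊥∣≡0 (n C))) z≤n }

  wf-move : WellFormed s → Move C S s s′ c → WellFormed s′
  wf-move {s = st r b f} wf (R1 v v∈b fits) = record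
    { red-settled    = red′
    ; blue-settled   = blue-settled wf
    ; fired-noninput = fired-noninput wf
    ; fired-closed   = fired-closed wf
    ; capacity       = fits }
    where
    red′ : u ∈ r ∪ ⁅ v ⁆ → Settled (st r b f) u
    red′ u∈ with ∈∪⁅⁆⁻ u∈
    ... | inj₁ u∈r = red-settled wf u∈r
    ... | inj₂ refl = blue-settled wf v∈b
  wf-move {s = st r b f} wf (R2 v v∈r) = record
    { red-settled    = red-settled wf
    ; blue-settled   = blue′
    ; fired-noninput = fired-noninput wf
    ; fired-closed   = fired-closed wf
    ; capacity       = capacity wf }
    where
    blue′ : u ∈ b ∪ ⁅ v ⁆ → Settled (st r b f) u
    blue′ u∈ with ∈∪⁅⁆⁻ u∈
    ... | inj₁ u∈b = blue-settled wf u∈b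
    ... | inj₂ refl = red-settled wf v∈r
  wf-move {s = st r b f} wf (R3NR v v∉I preds _ fits) = record
    { red-settled    = red′
    ; blue-settled   = settled-grow v ∘ blue-settled wf
    ; fired-noninput = noninput′
    ; fired-closed   = closed′
    ; capacity       = fits }
    where
    red′ : u ∈ r ∪ ⁅ v ⁆ → Settled (st r b (f ∪ ⁅ v ⁆)) u
    red′ u∈ with ∈∪⁅⁆⁻ u∈
    ... | inj₁ u∈r = settled-grow v (red-settled wf u∈r)
    ... | inj₂ refl = inj₁ (q⊆p∪q f ⁅ v ⁆ (x∈⁅x⁆ v))
    noninput′ : u ∈ f ∪ ⁅ v ⁆ → u ∉ I C
    noninput′ u∈ with ∈∪⁅⁆⁻ u∈
    ... | inj₁ u∈f = fired-noninput wf u∈f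
    ... | inj₂ refl = v∉I
    closed′ : w ∈ f ∪ ⁅ v ⁆ → E C u w ≡ true → Settled (st r b (f ∪ ⁅ v ⁆)) u
    closed′ w∈ e with ∈∪⁅⁆⁻ w∈
    ... | inj₁ w∈f = settled-grow v (fired-closed wf w∈f e)
    ... | inj₂ refl = settled-grow v (red-settled wf (preds _ e))
  wf-move {s = st r b f} wf (R4 v _) = record
    { red-settled    = red-settled wf ∘ p─q⊆p r ⁅ v ⁆
    ; blue-settled   = blue-settled wf
    ; fired-noninput = fired-noninput wf
    ; fired-closed   = fired-closed wf
    ; capacity       = ≤-trans (p⊆q⇒∣p∣≤∣q∣ (p─q⊆p r ⁅ v ⁆)) (capacity wf) }

  wf-run : WellFormed s → Run C S s s′ q → WellFormed s′
  wf-run wf done = wf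
  wf-run wf (mv ∷ rr) = wf-run (wf-move wf mv) rr

  fired-mono-move : Move C S s s′ c → fired s ⊆ fired s′
  fired-mono-move (R1 _ _ _) = id
  fired-mono-move (R2 _ _) = id
  fired-mono-move (R3NR v _ _ _ _) = p⊆p∪q ⁅ v ⁆
  fired-mono-move (R4 _ _) = id

  fired-mono : Run C S s s′ q → fired s ⊆ fired s′
  fired-mono done = id
  fired-mono (mv ∷ rr) = fired-mono rr ∘ fired-mono-move mv

  new-unsettled : WellFormed s → Run C S s s′ q → u ∈ fired s′ ─ fired s → ¬ Settled s u
  new-unsettled {s = s} {s′ = s′} wf rr u∈new (inj₁ u∈old) = x∈p─q⇒x∉q (fired s′) (fired s) u∈new u∈old
  new-unsettled {s = s} {s′ = s′} wf rr u∈new (inj₂ u∈I) =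
    fired-noninput (wf-run wf rr) (p─q⊆p (fired s′) (fired s) u∈new) u∈I

  ioSet : Run C S s s′ q → Subset (n C)
  ioSet done = ⊥
  ioSet (R1 v _ _ ∷ rr) = ioSet rr ∪ ⁅ v ⁆
  ioSet (R2 v _ ∷ rr) = ioSet rr ∪ ⁅ v ⁆
  ioSet (R3NR _ _ _ _ _ ∷ rr) = ioSet rr
  ioSet (R4 _ _ ∷ rr) = ioSet rr

  ∣ioSet∣≤cost : (rr : Run C S s s′ q) → ∣ ioSet rr ∣ ≤ q
  ∣ioSet∣≤cost done = ≤-reflexive (∣⊥∣≡0 (n C))
  ∣ioSet∣≤cost (R1 v _ _ ∷ rr) = ≤-trans (∣p∪⁅x⁆∣≤1+∣p∣ (ioSet rr) v) (s≤s (∣ioSet∣≤cost rr))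
  ∣ioSet∣≤cost (R2 v _ ∷ rr) = ≤-trans (∣p∪⁅x⁆∣≤1+∣p∣ (ioSet rr) v) (s≤s (∣ioSet∣≤cost rr))
  ∣ioSet∣≤cost (R3NR _ _ _ _ _ ∷ rr) = ∣ioSet∣≤cost rr
  ∣ioSet∣≤cost (R4 _ _ ∷ rr) = ∣ioSet∣≤cost rr

  -- Source of In(V_i): a predecessor u of a vertex v fired during a run, u itself not
  -- fired during the run, is red at the start or touched by an I/O move, because u
  -- is red at the moment v fires.
  inflow-source : (rr : Run C S s s′ q) → E C u v ≡ true → v ∈ fired s′ ─ fired s →
                  (u ∈ fired s′ → u ∈ fired s) → u ∈ red s ⊎ u ∈ ioSet rr
  inflow-source {s = s} {s′ = s′} done e v∈new old =
    contradiction (p─q⊆p (fired s′) (fired s) v∈new) (x∈p─q⇒x∉q (fired s′) (fired s) v∈new)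
  inflow-source (R1 _ _ _ ∷ rr) e v∈new old = shift-singleton (inflow-source rr e v∈new old)
  inflow-source (R2 w _ ∷ rr) e v∈new old =
    map₂ (p⊆p∪q ⁅ w ⁆) (inflow-source rr e v∈new old)
  inflow-source {s = st r b f} (R4 w _ ∷ rr) e v∈new old =
    map₁ (p─q⊆p r ⁅ w ⁆) (inflow-source rr e v∈new old)
  inflow-source {s = st r b f} {s′ = s′} {u = u} {v = v} (R3NR w _ preds w∉f _ ∷ rr) e v∈new old
    with v ≟ w | u ≟ w
  ... | yes refl | _ = inj₁ (preds u e)
  ... | no _ | yes refl = contradiction (old (fired-mono rr (q⊆p∪q f ⁅ u ⁆ (x∈⁅x⁆ u)))) w∉f
  ... | no v≢w | no u≢w = map₁ (λ u∈ → ∈∪⁅⁆-≢ u∈ u≢w)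
                               (inflow-source rr e v∈new′ (p⊆p∪q ⁅ w ⁆ ∘ old))
    where
    v∈new′ : v ∈ fired s′ ─ (f ∪ ⁅ w ⁆)
    v∈new′ = x∈p∧x∉q⇒x∈p─q (p─q⊆p (fired s′) f v∈new) (∉∪⁅⁆ (x∈p─q⇒x∉q (fired s′) f v∈new) v≢w)

  -- Blue pebbles are only created by R2 moves.
  blue-source : (rr : Run C S s s′ q) → u ∈ blue s′ → u ∈ blue s ⊎ u ∈ ioSet rr
  blue-source done u∈ = inj₁ u∈
  blue-source (R1 w _ _ ∷ rr) u∈ = map₂ (p⊆p∪q ⁅ w ⁆) (blue-source rr u∈)
  blue-source (R2 _ _ ∷ rr) u∈ = shift-singleton (blue-source rr u∈)
  blue-source (R3NR _ _ _ _ _ ∷ rr) u∈ = blue-source rr u∈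
  blue-source (R4 _ _ ∷ rr) u∈ = blue-source rr u∈

  -- A dead vertex has been fired and carries no pebble.  Without recomputation it
  -- can never regain a red pebble, hence never a blue one, and none of its
  -- successors can ever be fired.
  Dead : Fin (n C) → State C → Set
  Dead u s = u ∉ red s × u ∉ blue s × u ∈ fired s

  dead-move : Dead u s → Move C S s s′ c → Dead u s′
  dead-move (u∉r , u∉b , u∈f) (R1 v v∈b _) = ∉∪⁅⁆ u∉r (≢-sym (∈∉⇒≢ v∈b u∉b)) , u∉b , u∈f
  dead-move (u∉r , u∉b , u∈f) (R2 v v∈r) = u∉r , ∉∪⁅⁆ u∉b (≢-sym (∈∉⇒≢ v∈r u∉r)) , u∈f
  dead-move (u∉r , u∉b , u∈f) (R3NR v _ _ v∉f _) = ∉∪⁅⁆ u∉r (∈∉⇒≢ u∈f v∉f) , u∉b , p⊆p∪q ⁅ v ⁆ u∈f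
  dead-move {s = st r b f} (u∉r , u∉b , u∈f) (R4 v _) = u∉r ∘ p─q⊆p r ⁅ v ⁆ , u∉b , u∈f

  dead-successor-move : Dead u s → E C u w ≡ true → w ∉ fired s → Move C S s s′ c → w ∉ fired s′
  dead-successor-move {u = u} (u∉r , _ , _) e w∉f (R3NR v _ preds _ _) =
    ∉∪⁅⁆ w∉f (λ w≡v → u∉r (preds u (subst (λ x → E C u x ≡ true) w≡v e)))
  dead-successor-move _ _ w∉f (R1 _ _ _) = w∉f
  dead-successor-move _ _ w∉f (R2 _ _) = w∉f
  dead-successor-move _ _ w∉f (R4 _ _) = w∉f

  stays-dead : Dead u s → Run C S s s′ q → Dead u s′
  stays-dead dead done = dead
  stays-dead dead (mv ∷ rr) = stays-dead (dead-move dead mv) rr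

  dead-successor-unfired : Dead u s → E C u w ≡ true → w ∉ fired s → Run C S s s′ q → w ∉ fired s′
  dead-successor-unfired dead e w∉f done = w∉f
  dead-successor-unfired dead e w∉f (mv ∷ rr) =
    dead-successor-unfired (dead-move dead mv) e (dead-successor-move dead e w∉f mv) rr

  dead-not-outflow : WellFormed s → ¬ Settled s u → Dead u s′ → Run C S s′ s″ q → Complete C s″ →
                     ¬ (u ∈ O C ⊎ ∃ λ w → E C u w ≡ true × w ∉ fired s′ ─ fired s)
  dead-not-outflow wf unsettled dead rest complete (inj₁ u∈O) =
    proj₁ (proj₂ (stays-dead dead rest)) (proj₂ complete _ u∈O)
  dead-not-outflow {s′ = s′} wf unsettled dead rest complete (inj₂ (w , e , w∉new)) =
    dead-successor-unfired dead e w∉now rest (proj₁ complete w (edge-target-noninput C e))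
    where
    w∉now : w ∉ fired s′
    w∉now w∈now = unsettled (fired-closed wf (x∈p∧x∉p─q⇒x∈q w∈now w∉new) e)

  -- Source of Out(V_i): a vertex of Out(fired s′ ─ fired s) is red at the end of the
  -- run or touched by an I/O move, since otherwise it is dead at s′.
  outflow-source : WellFormed s → (rr : Run C S s s′ q) → Run C S s′ s″ c → Complete C s″ →
                   u ∈ OutSet C (fired s′ ─ fired s) → u ∈ red s′ ⊎ u ∈ ioSet rr
  outflow-source {s = s} {s′ = s′} {u = u} wf rr rest complete u∈Out
    with OutSet-member C u∈Out | u ∈? red s′ | u ∈? ioSet rr
  ... | _ | yes u∈r | _ = inj₁ u∈r
  ... | _ | no _ | yes u∈io = inj₂ u∈io
  ... | u∈new , why | no u∉r | no u∉io = ⊥-elim (dead-not-outflow wf unsettled dead rest complete why)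
    where
    unsettled : ¬ Settled s u
    unsettled = new-unsettled wf rr u∈new
    u∉b : u ∉ blue s′
    u∉b u∈b with blue-source rr u∈b
    ... | inj₁ u∈b₀ = unsettled (blue-settled wf u∈b₀)
    ... | inj₂ u∈io = u∉io u∈io
    dead : Dead u s′
    dead = u∉r , u∉b , p─q⊆p (fired s′) (fired s) u∈new

  segment-bound : ∀ {X Y} (rr : Run C S s s′ q) → q ≤ S → ∣ X ∣ ≤ S →
                  (∀ {x} → x ∈ Y → x ∈ X ⊎ x ∈ ioSet rr) → ∣ Y ∣ ≤ 2 * S
  segment-bound {X = X} {Y} rr q≤S X≤S cover = begin
    ∣ Y ∣                ≤⟨ card-cover cover ⟩
    ∣ X ∣ + ∣ ioSet rr ∣  ≤⟨ +-mono-≤ X≤S (≤-trans (∣ioSet∣≤cost rr) q≤S) ⟩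
    S + S                ≡⟨ cong (S +_) (sym (+-identityʳ S)) ⟩
    2 * S                ∎
    where open ≤-Reasoning

  in-bound : WellFormed s → (rr : Run C S s s′ q) → q ≤ S →
             ∣ InSet C (fired s′ ─ fired s) ∣ ≤ 2 * S
  in-bound {s = s} {s′ = s′} wf rr q≤S = segment-bound rr q≤S (capacity wf) source
    where
    source : ∀ {u} → u ∈ InSet C (fired s′ ─ fired s) → u ∈ red s ⊎ u ∈ ioSet rr
    source u∈In with InSet-member C u∈In
    ... | u∉new , v , e , v∈new = inflow-source rr e v∈new (λ u∈ → x∈p∧x∉p─q⇒x∈q u∈ u∉new)

  out-bound : WellFormed s → (rr : Run C S s s′ q) → q ≤ S → Run C S s′ s″ c → Complete C s″ →
              ∣ OutSet C (fired s′ ─ fired s) ∣ ≤ 2 * S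
  out-bound wf rr q≤S rest complete =
    segment-bound rr q≤S (capacity (wf-run wf rr)) (outflow-source wf rr rest complete)

  Reaches : State C → State C → Set
  Reaches s s′ = ∃ (Run C S s s′)

  _++_ : Run C S s s′ q → Run C S s′ s″ c → Reaches s s″
  done ++ rr′ = _ , rr′
  (mv ∷ rr) ++ rr′ = _ , mv ∷ proj₂ (rr ++ rr′)

  data Segmentation : State C → State C → ℕ → Set where
    final : Run C S s s′ q → q ≤ S → Segmentation s s′ zero
    _▸_   : Run C S s s′ S → Segmentation s′ s″ h → Segmentation s s″ (suc h)

  whole : Segmentation s s′ h → Reaches s s′
  whole (final rr _) = _ , rr
  whole (rr ▸ sg) = rr ++ proj₂ (whole sg)

  take-io : (k : ℕ) → Run C S s s″ q → k ≤ q →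
            Σ (State C) λ s′ → Run C S s s′ k × Run C S s′ s″ (q ∸ k)
  take-io {s = s} zero rr _ = s , done , rr
  take-io (suc k) (R1 v a b ∷ rr) (s≤s k≤q) with take-io k rr k≤q
  ... | s′ , first , rest = s′ , R1 v a b ∷ first , rest
  take-io (suc k) (R2 v a ∷ rr) (s≤s k≤q) with take-io k rr k≤q
  ... | s′ , first , rest = s′ , R2 v a ∷ first , rest
  take-io (suc k) (R3NR v a b c d ∷ rr) k≤q with take-io (suc k) rr k≤q
  ... | s′ , first , rest = s′ , R3NR v a b c d ∷ first , rest
  take-io (suc k) (R4 v a ∷ rr) k≤q with take-io (suc k) rr k≤q
  ... | s′ , first , rest = s′ , R4 v a ∷ first , rest

  -- Every run of cost q has a segmentation into h + 1 segments with S * h ≤ q; the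
  -- recursion is on a fuel bound for q, which drops by S ≥ 1 per segment.
  segment : 1 ≤ S → (fuel : ℕ) → q ≤ fuel → Run C S s s′ q →
            Σ ℕ λ h → Segmentation s s′ h × S * h ≤ q
  segment {q = q} 1≤S fuel q≤fuel rr with q ≤? S
  ... | yes q≤S = 0 , final rr q≤S , ≤-trans (≤-reflexive (*-zeroʳ S)) z≤n
  segment 1≤S zero q≤0 rr | no q≰S = contradiction (≤-trans q≤0 z≤n) q≰S
  segment 1≤S (suc fuel) q≤fuel rr | no q≰S with take-io S rr (<⇒≤ (≰⇒> q≰S))
  ... | _ , first , rest with segment 1≤S fuel (peel-fuel 1≤S q≤fuel) rest
  ...   | h , sg , cost = suc h , first ▸ sg , peel-cost (<⇒≤ (≰⇒> q≰S)) cost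

  block : Segmentation s s′ h → Fin (suc h) → Subset (n C)
  block {s = s} {s′ = s′} (final _ _) _ = fired s′ ─ fired s
  block {s = s} (_▸_ {s′ = s₁} _ _) zero = fired s₁ ─ fired s
  block (_ ▸ sg) (suc i) = block sg i

  block-new : (sg : Segmentation s s′ h) (i : Fin (suc h)) → v ∈ block sg i → v ∈ fired s′ ─ fired s
  block-new (final _ _) _ v∈ = v∈
  block-new {s = s} (_▸_ {s′ = s₁} _ sg) zero v∈ =
    x∈p∧x∉q⇒x∈p─q (fired-mono (proj₂ (whole sg)) (p─q⊆p (fired s₁) (fired s) v∈))
                   (x∈p─q⇒x∉q (fired s₁) (fired s) v∈)
  block-new {s′ = s′} (_▸_ {s′ = s₁} first sg) (suc i) v∈ =
    x∈p∧x∉q⇒x∈p─q (p─q⊆p (fired s′) (fired s₁) v∈new) (x∈p─q⇒x∉q (fired s′) (fired s₁) v∈new ∘ fired-mono first)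
    where
    v∈new = block-new sg i v∈

  block-noninput : WellFormed s → (sg : Segmentation s s′ h) (i : Fin (suc h)) → v ∈ block sg i → v ∉ I C
  block-noninput {s = s} {s′ = s′} wf sg i v∈ =
    fired-noninput (wf-run wf (proj₂ (whole sg))) (p─q⊆p (fired s′) (fired s) (block-new sg i v∈))

  block-disjoint : (sg : Segmentation s s′ h) (i j : Fin (suc h)) → i ≢ j →
                   v ∈ block sg i → v ∈ block sg j → Empty
  block-disjoint (final _ _) zero zero i≢j _ _ = i≢j refl
  block-disjoint (_ ▸ _) zero zero i≢j _ _ = i≢j refl
  block-disjoint {s = s} (_▸_ {s′ = s₁} _ sg) zero (suc j) _ v∈₀ v∈ =
    x∈p─q⇒x∉q _ (fired s₁) (block-new sg j v∈) (p─q⊆p (fired s₁) (fired s) v∈₀)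
  block-disjoint {s = s} (_▸_ {s′ = s₁} _ sg) (suc i) zero _ v∈ v∈₀ =
    x∈p─q⇒x∉q _ (fired s₁) (block-new sg i v∈) (p─q⊆p (fired s₁) (fired s) v∈₀)
  block-disjoint (_ ▸ sg) (suc i) (suc j) i≢j =
    block-disjoint sg i j (i≢j ∘ cong suc)

  block-cover : (sg : Segmentation s s′ h) → v ∈ fired s′ ─ fired s → ∃ λ i → v ∈ block sg i
  block-cover (final _ _) v∈new = zero , v∈new
  block-cover {s = s} {s′ = s′} {v = v} (_▸_ {s′ = s₁} _ sg) v∈new with v ∈? fired s₁
  ... | yes v∈₁ = zero , x∈p∧x∉q⇒x∈p─q v∈₁ (x∈p─q⇒x∉q (fired s′) (fired s) v∈new)
  ... | no v∉₁ with block-cover sg (x∈p∧x∉q⇒x∈p─q (p─q⊆p (fired s′) (fired s) v∈new) v∉₁)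
  ...   | i , v∈ = suc i , v∈

  -- (P2) Edges never lead to an earlier block, because predecessors fire first.
  block-order : WellFormed s → (sg : Segmentation s s′ h) (i j : Fin (suc h)) →
                u ∈ block sg i → v ∈ block sg j → E C u v ≡ true → toℕ i ≤ toℕ j
  block-order wf (final _ _) zero zero _ _ _ = z≤n
  block-order wf (_ ▸ _) zero j _ _ _ = z≤n
  block-order {s = s} wf (_▸_ {s′ = s₁} first sg) (suc i) zero u∈ v∈₀ e =
    ⊥-elim (new-unsettled (wf-run wf first) (proj₂ (whole sg)) (block-new sg i u∈)
             (fired-closed (wf-run wf first) (p─q⊆p (fired s₁) (fired s) v∈₀) e))
  block-order wf (first ▸ sg) (suc i) (suc j) u∈ v∈ e =
    s≤s (block-order (wf-run wf first) sg i j u∈ v∈ e)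

  block-in : WellFormed s → (sg : Segmentation s s′ h) (i : Fin (suc h)) →
             ∣ InSet C (block sg i) ∣ ≤ 2 * S
  block-in wf (final rr q≤S) zero = in-bound wf rr q≤S
  block-in wf (first ▸ sg) zero = in-bound wf first ≤-refl
  block-in wf (first ▸ sg) (suc i) = block-in (wf-run wf first) sg i

  block-out : WellFormed s → Complete C s′ → (sg : Segmentation s s′ h) (i : Fin (suc h)) →
              ∣ OutSet C (block sg i) ∣ ≤ 2 * S
  block-out wf complete (final rr q≤S) zero = out-bound wf rr q≤S done complete
  block-out wf complete (first ▸ sg) zero = out-bound wf first ≤-refl (proj₂ (whole sg)) complete
  block-out wf complete (first ▸ sg) (suc i) = block-out (wf-run wf first) complete sg i

  partition : Segmentation (initial C) s′ h → Complete C s′ → Partition2S C S (suc h)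
  partition sg complete = record
    { block       = block sg
    ; sub         = λ i v → block-noninput wf-initial sg i
    ; disjoint    = λ i j v → block-disjoint sg i j
    ; cover       = λ v v∉I → block-cover sg (x∈p∧x∉q⇒x∈p─q (proj₁ complete v v∉I) ∉⊥)
    ; quotAcyclic = measure⇒acyclic toℕ increases
    ; inBound     = block-in wf-initial sg
    ; outBound    = block-out wf-initial complete sg }
    where
    increases : ∀ {i j} → i ≢ j × (Σ (Fin (n C)) λ u → Σ (Fin (n C)) λ v →
                  u ∈ block sg i × v ∈ block sg j × E C u v ≡ true) → toℕ i < toℕ j
    increases {i} {j} (i≢j , u , v , u∈ , v∈ , e) =
      ≤∧≢⇒< (block-order wf-initial sg i j u∈ v∈ e) (i≢j ∘ toℕ-injective)

lemma2 : (C : CDAG) (S : ℕ) → 1 ≤ S → (H : ℕ) → IsMinPartitionCount C S H →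
         ∀ (s : State C) (q : ℕ) → Run C S (initial C) s q → Complete C s →
         S * (H ∸ 1) ≤ q
lemma2 C S 1≤S H (_ , minimal) s q run complete with Game.segment C S 1≤S q ≤-refl run
... | h , sg , cost = begin
  S * (H ∸ 1)  ≤⟨ *-monoʳ-≤ S (∸-monoˡ-≤ 1 (minimal (suc h) (Game.partition C S sg complete))) ⟩
  S * h        ≤⟨ cost ⟩
  q            ∎
  where open ≤-Reasoning
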